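{- Let $n,m\ge3$ be odd integers with $3\nmid m$. If $S$ is a strong (resp. skew) Skolem starter in $\mathbb{Z}_n$ and $T$ is a strong (resp. skew) Skolem starter in $\mathbb{Z}_m$, then every cardioidal product $W^c_{ST}$ is a strong (resp. skew) Skolem starter in $\mathbb{Z}_{mn}$.
   Context: For odd $k=2\ell+1$, $\mathbb{Z}_k^*=\mathbb{Z}_k\setminus\{0\}$, ordered $1<\dots<k-1$. A 2-partition of $\mathbb{Z}_k^*$ is a partition into unordered pairs $\{x_i,y_i\}$; it is a starter if $\{\pm(x_i-y_i)\bmod k\}=\mathbb{Z}_k^*$; strong if the sums $x_i+y_i\bmod k$ are nonzero and pairwise distinct; skew if $\{\pm(x_i+y_i)\bmod k\}=\mathbb{Z}_k^*$; Skolem if every pair $\{x,y\}$ with $x<y$ satisfies $y-x\le\ell$. A strong (skew) Skolem starter is a starter that is strong (skew) and Skolem. Cardioidal product: with $n=2q+1$, $m=2p+1$, let $C_m=\{(i,2i\bmod m):1\le i\le m-1\}$, and let $\tilde S$ (resp. $\tilde T$) be any set of ordered pairs obtained by ordering each pair of $S$ (resp. $T$) in either way. $W^c_{ST}$ consists of the unordered pairs $\{nr+x,\ nt+y\}$ (mod $nm$, with $x,y$ represented in $\{0,\dots,n-1\}$) of two types: (i) one pair for each $(x,y)\in\tilde S$ and each $(r,t)\in\{(0,0)\}\cup C_m$; (ii) one pair for each $(r,t)\in\tilde T$ with $x=y=0$. -}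

module Defs where

open import Data.Nat using (ℕ; zero; suc; _+_; _*_; _∸_; _≤_; _%_; _/_; pred; ∣_-_∣)
open import Data.Product using (_×_; _,_)
open import Data.List using (List; []; _∷_; map; concatMap; upTo)
open import Data.List.Relation.Unary.All using (All)
open import Data.List.Relation.Unary.Unique.Propositional using (Unique)
open import Data.List.Relation.Binary.Permutation.Propositional using (_↭_)
open import Relation.Binary.PropositionalEquality using (_≢_)

-- Reduction modulo k (total; k = 0 never occurs in the statement since k is odd).
_mod_ : ℕ → ℕ → ℕ
a mod zero    = a
a mod (suc k) = a % suc k

-- Z_k^* = {1, …, k-1}, elements of Z_k represented by 0..k-1.
Zstar : ℕ → List ℕ
Zstar k = map suc (upTo (pred k))

-- A 2-partition is given as a list of pairs; each unordered pair {x,y} is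
-- stored as an ordered pair (x , y) in some (arbitrary) orientation.
Pairs : Set
Pairs = List (ℕ × ℕ)

elems : Pairs → List ℕ
elems = concatMap (λ { (x , y) → x ∷ y ∷ [] })

dif : ℕ → ℕ → ℕ → ℕ
dif k x y = (x + k ∸ y) mod k

sm : ℕ → ℕ → ℕ → ℕ
sm k x y = (x + y) mod k

negsm : ℕ → ℕ → ℕ → ℕ
negsm k x y = (k ∸ sm k x y) mod k

IsTwoPartition : ℕ → Pairs → Set
IsTwoPartition k P = elems P ↭ Zstar k

IsStarter : ℕ → Pairs → Set
IsStarter k P = IsTwoPartition k P
  × concatMap (λ { (x , y) → dif k x y ∷ dif k y x ∷ [] }) P ↭ Zstar k

IsStrong : ℕ → Pairs → Set
IsStrong k P = All (λ { (x , y) → sm k x y ≢ 0 }) P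
  × Unique (map (λ { (x , y) → sm k x y }) P)

IsSkew : ℕ → Pairs → Set
IsSkew k P = concatMap (λ { (x , y) → sm k x y ∷ negsm k x y ∷ [] }) P ↭ Zstar k

-- Skolem: every pair {x,y}, x<y, has y - x ≤ ℓ where k = 2ℓ+1 (ℓ = k / 2).
IsSkolem : ℕ → Pairs → Set
IsSkolem k P = All (λ { (x , y) → ∣ x - y ∣ ≤ k / 2 }) P

IsStrongSkolemStarter : ℕ → Pairs → Set
IsStrongSkolemStarter k P = IsStarter k P × IsStrong k P × IsSkolem k P

IsSkewSkolemStarter : ℕ → Pairs → Set
IsSkewSkolemStarter k P = IsStarter k P × IsSkew k P × IsSkolem k P

Cm : ℕ → Pairs
Cm m = map (λ i → (i , (2 * i) mod m)) (Zstar m)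

-- Cardioidal product W^c_{ST} in Z_{nm}.  The orientations S̃, T̃ are the
-- orientations in which the pairs of S and T are stored in the lists.
cardioidal : ℕ → ℕ → Pairs → Pairs → Pairs
cardioidal n m S T =
  concatMap (λ { (x , y) →
     map (λ { (r , t) → ((n * r + x) mod (n * m) , (n * t + y) mod (n * m)) })
         ((0 , 0) ∷ Cm m) }) S
  Data.List.++
  map (λ { (r , t) → ((n * r) mod (n * m) , (n * t) mod (n * m)) }) T

-- Write the elements of ℤ_{nm} in mixed radix as n * q + r with r < n and q < m.  A pair
-- {x, y} of S lifts to the m pairs {n i + x, n (2i mod m) + y}, i < m, and a pair {r, t} of T
-- to {n r, n t}.  For each quantity entering the definitions (the two elements, the two
-- differences, the sum and the negated sum) the values on the m lifts of {x, y} are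
-- n * g i + w (mod nm), where w is the value on {x, y} and g i is congruent modulo m to
-- ±k i + c with k ∈ {1, 2, 3}.  As m is odd and 3 ∤ m, g is a bijection modulo m, so these
-- values run exactly once through the residue class of w modulo n, while the lifts of T
-- contribute n times the values on T.  Hence the multiplicity of a over W^c_{ST} is that of
-- a mod n over S plus, when n ∣ a, that of a / n over T; so being a permutation of ℤ_k^*,
-- or avoiding 0 without repetition, passes from S and T to the product.
-- The Skolem bound comes from |i − (2i mod m)| ≤ (m − 1)/2.

module Submission where

open import Defs
open import Data.Nat using (ℕ; _≤_; _*_; _%_)
open import Data.Nat.Divisibility using (_∣_)
open import Data.Product using (_×_)
open import Relation.Nullary using (¬_)
open import Relation.Binary.PropositionalEquality using (_≡_)

open import Data.Bool using (if_then_else_)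
open import Data.List using (List; []; _∷_; _++_; map; applyUpTo; upTo; concatMap; length)
open import Data.List.Properties using (length-applyUpTo; map-applyUpTo; map-cong; map-∘; map-upTo; map-++)
open import Data.List.Membership.Propositional using (_∈_)
open import Data.List.Membership.Propositional.Properties using (∈-∃++; ∈-upTo⁺)
open import Data.List.Relation.Unary.All using (All; []; _∷_)
import Data.List.Relation.Unary.All as All
import Data.List.Relation.Unary.All.Properties as Allₚ
open import Data.List.Relation.Unary.Any using (here; there)
open import Data.List.Relation.Unary.AllPairs using ([]; _∷_)
open import Data.List.Relation.Unary.Unique.Propositional using (Unique)
import Data.List.Relation.Unary.Unique.Propositional.Properties as Uniqueₚ
open import Data.List.Relation.Binary.Permutation.Propositional
  using (_↭_; refl; prep; swap; trans; ↭-sym; ↭-trans)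
open import Data.List.Relation.Binary.Permutation.Propositional.Properties using (shift; All-resp-↭)
open import Data.Nat.Base
  using (_≡ᵇ_; _<_; pred; _+_; _∸_; _/_; ∣_-_∣; suc; zero; s≤s; z≤n; z<s; s<s; NonZero; >-nonZero⁻¹)
open import Data.Nat.Coprimality using (Coprime; coprime-divisor; 1-coprimeTo)
import Data.Nat.Coprimality as Coprime
open import Data.Nat.Divisibility using (divides; ∣⇒≤; n∣m⇒m%n≡0)
open import Data.Nat.DivMod
  using ( m≡m%n+[m/n]*n; [m+kn]%n≡m%n; [m+n]%n≡m%n; m%n%n≡m%n; m<n⇒m%n≡m; m%n<n; m%n≤n; n%n≡0
        ; %-congʳ; [m*n+o]%[p*n]≡[m*n]%[p*n]+o; m%n*o≡m*o%[n*o]; m≤n⇒[n∸m]%m≡n%m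
        ; m<n*o⇒m/o<n; /-congˡ; +-distrib-/-∣ʳ; m*n/n≡m)
open import Data.Nat.Primality using (Prime; prime?; prime⇒irreducible)
open import Data.Nat.Properties
open import Algebra.Properties.CommutativeSemigroup +-commutativeSemigroup
  using (interchange; xy∙z≈xz∙y; x∙yz≈y∙xz)
open import Data.Nat.Solver using (module +-*-Solver)
open +-*-Solver using (solve; _:+_; _:*_; _:=_; con)
open import Data.Product using (_,_; proj₁)
open import Data.Sum using (inj₁; inj₂)
open import Function using (_∘_)
open import Relation.Nullary using (yes; no; contradiction)
open import Relation.Nullary.Decidable using (from-yes)
open import Relation.Binary.PropositionalEquality
  using (_≢_; refl; sym; cong; cong₂; subst; subst₂; module ≡-Reasoning)
  renaming (trans to ≡-trans)

-- Multiplicities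

-- Defined through _≡ᵇ_ so that δ (suc a) (suc b) reduces to δ a b.
δ : ℕ → ℕ → ℕ
δ a b = if a ≡ᵇ b then 1 else 0

δ-refl : ∀ a → δ a a ≡ 1
δ-refl zero    = refl
δ-refl (suc a) = δ-refl a

δ-≡ : ∀ {a b} → a ≡ b → δ a b ≡ 1
δ-≡ {a} refl = δ-refl a

δ-≢ : ∀ {a b} → a ≢ b → δ a b ≡ 0
δ-≢ {zero}  {zero}  a≢b = contradiction refl a≢b
δ-≢ {zero}  {suc b} _   = refl
δ-≢ {suc a} {zero}  _   = refl
δ-≢ {suc a} {suc b} a≢b = δ-≢ (a≢b ∘ cong suc)

count : ℕ → List ℕ → ℕ
count a []       = 0
count a (x ∷ xs) = δ a x + count a xs

count-++ : ∀ a xs ys → count a (xs ++ ys) ≡ count a xs + count a ys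
count-++ a []       ys = refl
count-++ a (x ∷ xs) ys = ≡-trans (cong (δ a x +_) (count-++ a xs ys)) (sym (+-assoc (δ a x) _ _))

↭⇒count≡ : ∀ {xs ys} → xs ↭ ys → ∀ a → count a xs ≡ count a ys
↭⇒count≡ refl         a = refl
↭⇒count≡ (prep x p)   a = cong (δ a x +_) (↭⇒count≡ p a)
↭⇒count≡ (swap x y p) a = ≡-trans (sym (+-assoc (δ a x) _ _))
  (≡-trans (cong₂ _+_ (+-comm (δ a x) (δ a y)) (↭⇒count≡ p a)) (+-assoc (δ a y) _ _))
↭⇒count≡ (trans p q)  a = ≡-trans (↭⇒count≡ p a) (↭⇒count≡ q a)

count>0⇒∈ : ∀ {a} xs → 0 < count a xs → a ∈ xs
count>0⇒∈ {a} (x ∷ xs) 0<c with a ≟ x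
... | yes a≡x = here a≡x
... | no a≢x  = there (count>0⇒∈ xs (subst (λ d → 0 < d + count a xs) (δ-≢ a≢x) 0<c))

count-head>0 : ∀ x xs → 0 < count x (x ∷ xs)
count-head>0 x xs = subst (λ d → 0 < d + count x xs) (sym (δ-refl x)) z<s

count≡⇒↭ : ∀ xs ys → (∀ a → count a xs ≡ count a ys) → xs ↭ ys
count≡⇒↭ []       []       _  = refl
count≡⇒↭ []       (y ∷ ys) c≡ = contradiction (≡-trans (c≡ y) (cong (_+ count y ys) (δ-refl y))) (λ ())
count≡⇒↭ (x ∷ xs) ys       c≡ with ∈-∃++ (count>0⇒∈ ys (subst (0 <_) (c≡ x) (count-head>0 x xs)))
... | ys₁ , ys₂ , refl = ↭-trans (prep x (count≡⇒↭ xs (ys₁ ++ ys₂) rest≡)) (↭-sym (shift x ys₁ ys₂))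
  where
  rest≡ : ∀ a → count a xs ≡ count a (ys₁ ++ ys₂)
  rest≡ a = +-cancelˡ-≡ (δ a x) _ _ (≡-trans (c≡ a) (↭⇒count≡ (shift x ys₁ ys₂) a))

All≢⇒count≡0 : ∀ {a xs} → All (a ≢_) xs → count a xs ≡ 0
All≢⇒count≡0 []           = refl
All≢⇒count≡0 (a≢x ∷ a∉xs) = cong₂ _+_ (δ-≢ a≢x) (All≢⇒count≡0 a∉xs)

count≡0⇒All≢ : ∀ {a} xs → count a xs ≡ 0 → All (a ≢_) xs
count≡0⇒All≢         []       _  = []
count≡0⇒All≢ {a} (x ∷ xs) c≡0 =
  (λ { refl → contradiction (≡-trans (sym c≡0) (cong (_+ count a xs) (δ-refl a))) (λ ()) })
  ∷ count≡0⇒All≢ xs (m+n≡0⇒n≡0 (δ a x) c≡0)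

Unique⇒count≤1 : ∀ {xs} → Unique xs → ∀ a → count a xs ≤ 1
Unique⇒count≤1 []                 a = z≤n
Unique⇒count≤1 {x ∷ xs} (x∉xs ∷ u) a with a ≟ x
... | yes refl = ≤-reflexive (cong₂ _+_ (δ-refl a) (All≢⇒count≡0 x∉xs))
... | no a≢x   = subst (λ d → d + count a xs ≤ 1) (sym (δ-≢ a≢x)) (Unique⇒count≤1 u a)

count≤1⇒Unique : ∀ xs → (∀ a → count a xs ≤ 1) → Unique xs
count≤1⇒Unique []       _  = []
count≤1⇒Unique (x ∷ xs) c≤1 =
  count≡0⇒All≢ xs (n≤0⇒n≡0 (≤-pred (subst (λ d → d + count x xs ≤ 1) (δ-refl x) (c≤1 x))))
  ∷ count≤1⇒Unique xs (λ a → ≤-trans (m≤n+m (count a xs) (δ a x)) (c≤1 a))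

∈⇒count>0 : ∀ {a xs} → a ∈ xs → 0 < count a xs
∈⇒count>0 {a} {x ∷ xs} (here refl)   = count-head>0 a xs
∈⇒count>0 {a} {x ∷ xs} (there a∈xs) = <-≤-trans (∈⇒count>0 a∈xs) (m≤n+m _ (δ a x))

Unique∧∈⇒count≡1 : ∀ {a xs} → Unique xs → a ∈ xs → count a xs ≡ 1
Unique∧∈⇒count≡1 {a} xs-unique a∈xs = ≤-antisym (Unique⇒count≤1 xs-unique a) (∈⇒count>0 a∈xs)

All<⇒count≡0 : ∀ {k b xs} → All (_< k) xs → k ≤ b → count b xs ≡ 0
All<⇒count≡0 xs<k k≤b = All≢⇒count≡0 (All.map (λ x<k b≡x → <⇒≱ x<k (subst (_ ≤_) b≡x k≤b)) xs<k)

All≢0⇒count0≡0 : ∀ {A : Set} (g : A → ℕ) {P} → All (λ p → g p ≢ 0) P → count 0 (map g P) ≡ 0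
All≢0⇒count0≡0 g P≢0 = All≢⇒count≡0 (Allₚ.map⁺ (All.map (λ g≢0 → g≢0 ∘ sym) P≢0))

count0≡0⇒All≢0 : ∀ {A : Set} (g : A → ℕ) P → count 0 (map g P) ≡ 0 → All (λ p → g p ≢ 0) P
count0≡0⇒All≢0 g P count≡0 = All.map (λ 0≢g → 0≢g ∘ sym) (Allₚ.map⁻ (count≡0⇒All≢ (map g P) count≡0))

count-suc-map-suc : ∀ b xs → count (suc b) (map suc xs) ≡ count b xs
count-suc-map-suc b []       = refl
count-suc-map-suc b (x ∷ xs) = cong (δ b x +_) (count-suc-map-suc b xs)

count-zero-map-suc : ∀ xs → count 0 (map suc xs) ≡ 0
count-zero-map-suc []       = refl
count-zero-map-suc (x ∷ xs) = count-zero-map-suc xs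

Zstar-bounded : ∀ k → All (_< k) (Zstar k)
Zstar-bounded zero    = []
Zstar-bounded (suc k) = Allₚ.map⁺ (All.map s<s (Allₚ.all-upTo k))

count-Zstar-zero : ∀ k → count 0 (Zstar k) ≡ 0
count-Zstar-zero k = count-zero-map-suc (upTo (pred k))

count-Zstar : ∀ {k b} → 0 < b → b < k → count b (Zstar k) ≡ 1
count-Zstar {suc k} {suc b} _ (s<s b<k) =
  ≡-trans (count-suc-map-suc b (upTo k)) (Unique∧∈⇒count≡1 (Uniqueₚ.upTo⁺ k) (∈-upTo⁺ b<k))

PairBelow : ℕ → ℕ × ℕ → Set
PairBelow k (x , y) = x < k × y < k

IsSkolemPair : ℕ → ℕ × ℕ → Set
IsSkolemPair k (x , y) = ∣ x - y ∣ ≤ k / 2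

twoPartition-bounded : ∀ {k P} → IsTwoPartition k P → All (PairBelow k) P
twoPartition-bounded {k} P↭ = pairs (All-resp-↭ (↭-sym P↭) (Zstar-bounded k))
  where
  pairs : ∀ {P} → All (_< k) (elems P) → All (PairBelow k) P
  pairs {[]}          []                    = []
  pairs {(x , y) ∷ P} (x<k ∷ y<k ∷ elems<k) = (x<k , y<k) ∷ pairs elems<k

-- Injective self-maps of {0, …, m - 1}

∑< : ℕ → (ℕ → ℕ) → ℕ
∑< zero    f = 0
∑< (suc m) f = f 0 + ∑< m (f ∘ suc)

∑<-zero : ∀ m → ∑< m (λ _ → 0) ≡ 0
∑<-zero zero    = refl
∑<-zero (suc m) = ∑<-zero m

∑<-+ : ∀ m f g → ∑< m (λ i → f i + g i) ≡ ∑< m f + ∑< m g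
∑<-+ zero    f g = refl
∑<-+ (suc m) f g = ≡-trans (cong (f 0 + g 0 +_) (∑<-+ m (f ∘ suc) (g ∘ suc)))
                           (interchange (f 0) (g 0) _ _)

∑<-δ : ∀ {m x} → x < m → ∑< m (λ b → δ b x) ≡ 1
∑<-δ {suc m} {zero}  _         = cong suc (∑<-zero m)
∑<-δ {suc m} {suc x} (s<s x<m) = ∑<-δ x<m

∑<-count : ∀ {m xs} → All (_< m) xs → ∑< m (λ b → count b xs) ≡ length xs
∑<-count {m} []                   = ∑<-zero m
∑<-count {m} {x ∷ xs} (x<m ∷ xs<m) = begin
  ∑< m (λ b → δ b x + count b xs)            ≡⟨ ∑<-+ m (λ b → δ b x) _ ⟩
  ∑< m (λ b → δ b x) + ∑< m (λ b → count b xs) ≡⟨ cong₂ _+_ (∑<-δ x<m) (∑<-count xs<m) ⟩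
  suc (length xs)                            ∎
  where open ≡-Reasoning

∑<-≤ : ∀ m f → (∀ {i} → i < m → f i ≤ 1) → ∑< m f ≤ m
∑<-≤ zero    f f≤1 = z≤n
∑<-≤ (suc m) f f≤1 = +-mono-≤ (f≤1 z<s) (∑<-≤ m (f ∘ suc) (f≤1 ∘ s<s))

+-≤-split : ∀ {a c m} → a ≤ 1 → c ≤ m → a + c ≡ suc m → a ≡ 1 × c ≡ m
+-≤-split z≤n       c≤m refl = contradiction c≤m 1+n≰n
+-≤-split (s≤s z≤n) _   a+c≡ = refl , suc-injective a+c≡

∑<≡⇒≡1 : ∀ m f → (∀ {i} → i < m → f i ≤ 1) → ∑< m f ≡ m → ∀ b → b < m → f b ≡ 1
∑<≡⇒≡1 (suc m) f f≤1 ∑≡m b b<m with +-≤-split (f≤1 z<s) (∑<-≤ m (f ∘ suc) (f≤1 ∘ s<s)) ∑≡m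
∑<≡⇒≡1 (suc m) f f≤1 ∑≡m zero    _         | f0≡1 , _    = f0≡1
∑<≡⇒≡1 (suc m) f f≤1 ∑≡m (suc b) (s<s b<m) | _    , rest = ∑<≡⇒≡1 m (f ∘ suc) (f≤1 ∘ s<s) rest b b<m

applyUpTo-cong : ∀ {A : Set} m (f g : ℕ → A) → (∀ {i} → i < m → f i ≡ g i) → applyUpTo f m ≡ applyUpTo g m
applyUpTo-cong zero    f g f≡g = refl
applyUpTo-cong (suc m) f g f≡g = cong₂ _∷_ (f≡g z<s) (applyUpTo-cong m (f ∘ suc) (g ∘ suc) (f≡g ∘ s<s))

InjectiveOn : ℕ → (ℕ → ℕ) → Set
InjectiveOn m h = ∀ {i j} → i < m → j < m → h i ≡ h j → i ≡ j

count-applyUpTo-bijection : ∀ m h → InjectiveOn m h → (∀ {i} → i < m → h i < m) →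
                            ∀ b → b < m → count b (applyUpTo h m) ≡ 1
count-applyUpTo-bijection m h h-inj h<m =
  ∑<≡⇒≡1 m (λ b → count b (applyUpTo h m)) (λ _ → Unique⇒count≤1 unique _)
    (≡-trans (∑<-count (Allₚ.applyUpTo⁺₁ h m h<m)) (length-applyUpTo h m))
  where
  unique : Unique (applyUpTo h m)
  unique = Uniqueₚ.applyUpTo⁺₁ h m (λ i<j j<m → <⇒≢ i<j ∘ h-inj (<-trans i<j j<m) j<m)

-- Congruences modulo m

∣∧<⇒≡0 : ∀ {m d} → m ∣ d → d < m → d ≡ 0
∣∧<⇒≡0 {d = zero}  _   _   = refl
∣∧<⇒≡0 {d = suc d} m∣d d<m = contradiction (∣⇒≤ m∣d) (<⇒≱ d<m)

module _ (m : ℕ) .{{_ : NonZero m}} where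

  %≡%⇒∣∣-∣ : ∀ a b → a % m ≡ b % m → m ∣ ∣ a - b ∣
  %≡%⇒∣∣-∣ a b a≡b = divides ∣ a / m - b / m ∣ (begin
    ∣ a - b ∣                                    ≡⟨ cong₂ ∣_-_∣ (m≡m%n+[m/n]*n a m) (m≡m%n+[m/n]*n b m) ⟩
    ∣ a % m + a / m * m - b % m + b / m * m ∣      ≡⟨ cong (λ r → ∣ a % m + a / m * m - r + b / m * m ∣) (sym a≡b) ⟩
    ∣ a % m + a / m * m - a % m + b / m * m ∣      ≡⟨ ∣m+n-m+o∣≡∣n-o∣ (a % m) _ _ ⟩
    ∣ a / m * m - b / m * m ∣                     ≡⟨ *-distribʳ-∣-∣ m (a / m) (b / m) ⟨
    ∣ a / m - b / m ∣ * m                         ∎)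
    where open ≡-Reasoning

  ∣∣-∣⇒%≡% : ∀ a b → m ∣ ∣ a - b ∣ → a % m ≡ b % m
  ∣∣-∣⇒%≡% a b (divides k ∣a-b∣≡) with ≤-total a b
  ... | inj₁ a≤b = sym (begin
    b % m                ≡⟨ cong (_% m) (m+[n∸m]≡n a≤b) ⟨
    (a + (b ∸ a)) % m    ≡⟨ cong (λ d → (a + d) % m) (≡-trans (sym (m≤n⇒∣m-n∣≡n∸m a≤b)) ∣a-b∣≡) ⟩
    (a + k * m) % m      ≡⟨ [m+kn]%n≡m%n a k m ⟩
    a % m                ∎)
    where open ≡-Reasoning
  ... | inj₂ b≤a = begin
    a % m                ≡⟨ cong (_% m) (m+[n∸m]≡n b≤a) ⟨
    (b + (a ∸ b)) % m    ≡⟨ cong (λ d → (b + d) % m) (≡-trans (sym (m≤n⇒∣n-m∣≡n∸m b≤a)) ∣a-b∣≡) ⟩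
    (b + k * m) % m      ≡⟨ [m+kn]%n≡m%n b k m ⟩
    b % m                ∎
    where open ≡-Reasoning

  %-+-congˡ : ∀ c {a b} → a % m ≡ b % m → (c + a) % m ≡ (c + b) % m
  %-+-congˡ c {a} {b} a≡b =
    ∣∣-∣⇒%≡% (c + a) (c + b) (subst (m ∣_) (sym (∣m+n-m+o∣≡∣n-o∣ c a b)) (%≡%⇒∣∣-∣ a b a≡b))

  %-+-congʳ : ∀ c {a b} → a % m ≡ b % m → (a + c) % m ≡ (b + c) % m
  %-+-congʳ c {a} {b} a≡b =
    subst₂ (λ x y → x % m ≡ y % m) (+-comm c a) (+-comm c b) (%-+-congˡ c a≡b)

  %-+-cancelˡ : ∀ c {a b} → (c + a) % m ≡ (c + b) % m → a % m ≡ b % m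
  %-+-cancelˡ c {a} {b} c+a≡c+b =
    ∣∣-∣⇒%≡% a b (subst (m ∣_) (∣m+n-m+o∣≡∣n-o∣ c a b) (%≡%⇒∣∣-∣ (c + a) (c + b) c+a≡c+b))

  %-+-cancelʳ : ∀ c {a b} → (a + c) % m ≡ (b + c) % m → a % m ≡ b % m
  %-+-cancelʳ c {a} {b} a+c≡b+c =
    %-+-cancelˡ c (subst₂ (λ x y → x % m ≡ y % m) (+-comm a c) (+-comm b c) a+c≡b+c)

  %-*-cancelˡ : ∀ {k a b} → Coprime m k → a < m → b < m → (k * a) % m ≡ (k * b) % m → a ≡ b
  %-*-cancelˡ {k} {a} {b} m⊥k a<m b<m ka≡kb = ∣m-n∣≡0⇒m≡n (∣∧<⇒≡0 m∣∣a-b∣ ∣a-b∣<m)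
    where
    m∣∣a-b∣ : m ∣ ∣ a - b ∣
    m∣∣a-b∣ = coprime-divisor m⊥k
      (subst (m ∣_) (sym (*-distribˡ-∣-∣ k a b)) (%≡%⇒∣∣-∣ (k * a) (k * b) ka≡kb))
    ∣a-b∣<m : ∣ a - b ∣ < m
    ∣a-b∣<m = ≤-<-trans (∣m-n∣≤m⊔n a b) (⊔-lub a<m b<m)

  affine-injectiveOn : ∀ {k} c g → Coprime m k → (∀ {i} → i < m → (g i + c) % m ≡ (k * i) % m) →
                       InjectiveOn m ((_% m) ∘ g)
  affine-injectiveOn c g m⊥k g≡ki i<m j<m gi≡gj =
    %-*-cancelˡ m⊥k i<m j<m (≡-trans (sym (g≡ki i<m)) (≡-trans (%-+-congʳ c gi≡gj) (g≡ki j<m)))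

  antiaffine-injectiveOn : ∀ {k} c g → Coprime m k → (∀ {i} → i < m → (g i + k * i + c) % m ≡ 0) →
                           InjectiveOn m ((_% m) ∘ g)
  antiaffine-injectiveOn {k} c g m⊥k g+ki≡0 {i} {j} i<m j<m gi≡gj =
    sym (%-*-cancelˡ m⊥k j<m i<m (%-+-cancelˡ (g i + c) (begin
      (g i + c + k * j) % m   ≡⟨ cong (_% m) (xy∙z≈xz∙y (g i) c (k * j)) ⟩
      (g i + k * j + c) % m   ≡⟨ %-+-congʳ c (%-+-congʳ (k * j) gi≡gj) ⟩
      (g j + k * j + c) % m   ≡⟨ g+ki≡0 j<m ⟩
      0                       ≡⟨ g+ki≡0 i<m ⟨
      (g i + k * i + c) % m   ≡⟨ cong (_% m) (xy∙z≈xz∙y (g i) (k * i) c) ⟩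
      (g i + c + k * i) % m   ∎)))
    where open ≡-Reasoning

prime∤⇒coprime : ∀ {p m} → Prime p → ¬ p ∣ m → Coprime m p
prime∤⇒coprime p-prime p∤m (d∣m , d∣p) with prime⇒irreducible p-prime d∣p
... | inj₁ d≡1 = d≡1
... | inj₂ refl = contradiction d∣m p∤m

odd⇒coprime-2 : ∀ {m} → m % 2 ≡ 1 → Coprime m 2
odd⇒coprime-2 {m} m-odd = prime∤⇒coprime (from-yes (prime? 2)) 2∤m
  where
  2∤m : ¬ 2 ∣ m
  2∤m 2∣m with ≡-trans (sym m-odd) (n∣m⇒m%n≡0 m 2 2∣m)
  ... | ()

-- Mixed radix in ℤ_{nm}

module Radix (n m : ℕ) .{{_ : NonZero n}} .{{_ : NonZero m}} where

  instance
    nm≢0 : NonZero (n * m)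
    nm≢0 = m*n≢0 n m

  [n*z+r]%nm : ∀ z {r} → r < n → (n * z + r) % (n * m) ≡ n * (z % m) + r
  [n*z+r]%nm z {r} r<n = begin
    (n * z + r) % (n * m)    ≡⟨ cong (λ u → (u + r) % (n * m)) (*-comm n z) ⟩
    (z * n + r) % (n * m)    ≡⟨ %-congʳ (*-comm n m) ⟩
    (z * n + r) % (m * n)    ≡⟨ [m*n+o]%[p*n]≡[m*n]%[p*n]+o z m r<n ⟩
    (z * n) % (m * n) + r    ≡⟨ cong (_+ r) (m%n*o≡m*o%[n*o] z m n) ⟨
    z % m * n + r            ≡⟨ cong (_+ r) (*-comm (z % m) n) ⟩
    n * (z % m) + r          ∎
    where
    open ≡-Reasoning
    instance _ = m*n≢0 m n

  n*[a/n]+a%n≡a : ∀ a → n * (a / n) + a % n ≡ a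
  n*[a/n]+a%n≡a a = ≡-trans (cong₂ _+_ (*-comm n (a / n)) refl) (≡-trans (+-comm _ (a % n)) (sym (m≡m%n+[m/n]*n a n)))

  n*a+[n*b+c]≡n*[a+b]+c : ∀ a b c → n * a + (n * b + c) ≡ n * (a + b) + c
  n*a+[n*b+c]≡n*[a+b]+c a b c = ≡-trans (sym (+-assoc (n * a) (n * b) c)) (cong (_+ c) (sym (*-distribˡ-+ n a b)))

  [n*q+r]%n≡r : ∀ q {r} → r < n → (n * q + r) % n ≡ r
  [n*q+r]%n≡r q {r} r<n = ≡-trans (cong (_% n) (≡-trans (+-comm (n * q) r) (cong (r +_) (*-comm n q))))
                                  (≡-trans ([m+kn]%n≡m%n r q n) (m<n⇒m%n≡m r<n))

  n*q+r-injective : ∀ {q r q′ r′} → r < n → r′ < n → n * q + r ≡ n * q′ + r′ → q ≡ q′ × r ≡ r′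
  n*q+r-injective {q} {r} {q′} {r′} r<n r′<n eq = q≡q′ , r≡r′
    where
    r≡r′ : r ≡ r′
    r≡r′ = ≡-trans (sym ([n*q+r]%n≡r q r<n)) (≡-trans (cong (_% n) eq) ([n*q+r]%n≡r q′ r′<n))
    q≡q′ : q ≡ q′
    q≡q′ = *-cancelˡ-≡ q q′ n (+-cancelʳ-≡ r _ _ (subst (λ x → n * q + r ≡ n * q′ + x) (sym r≡r′) eq))

  δ-radix : ∀ a z {r} → r < n → δ a (n * z + r) ≡ δ (a % n) r * δ (a / n) z
  δ-radix a z {r} r<n with a ≟ n * z + r
  ... | yes a≡nz+r with n*q+r-injective (m%n<n a n) r<n (≡-trans (n*[a/n]+a%n≡a a) a≡nz+r)
  ...   | q≡z , a%n≡r rewrite δ-≡ a≡nz+r | δ-≡ a%n≡r | δ-≡ q≡z = refl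
  δ-radix a z {r} r<n | no a≢nz+r with a % n ≟ r | a / n ≟ z
  ...   | no a%n≢r | _        rewrite δ-≢ a≢nz+r | δ-≢ a%n≢r = refl
  ...   | yes _    | no a/n≢z rewrite δ-≢ a≢nz+r | δ-≢ a/n≢z = sym (*-zeroʳ (δ (a % n) r))
  ...   | yes refl | yes refl = contradiction (sym (n*[a/n]+a%n≡a a)) a≢nz+r

  count-radix : ∀ a {r} → r < n → ∀ zs → count a (map (λ z → n * z + r) zs) ≡ δ (a % n) r * count (a / n) zs
  count-radix a {r} r<n []       = sym (*-zeroʳ (δ (a % n) r))
  count-radix a {r} r<n (z ∷ zs) =
    ≡-trans (cong₂ _+_ (δ-radix a z r<n) (count-radix a r<n zs)) (sym (*-distribˡ-+ (δ (a % n) r) _ _))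

  -- Modulo nm the column is n * h i + w % n with h a bijection of {0, …, m - 1}, so it meets
  -- every a ≡ w (mod n) below nm exactly once.
  count-column : ∀ (v g : ℕ → ℕ) w → (∀ {i} → i < m → v i ≡ (n * g i + w) % (n * m)) →
                 InjectiveOn m ((_% m) ∘ g) → ∀ a → a < n * m → count a (applyUpTo v m) ≡ δ (a % n) (w % n)
  count-column v g w v≡ g-inj a a<nm = begin
    count a (applyUpTo v m)
      ≡⟨ cong (count a) (applyUpTo-cong m v _ v≡radix) ⟩
    count a (applyUpTo (λ i → n * h i + w % n) m)
      ≡⟨ cong (count a) (map-applyUpTo h (λ z → n * z + w % n) m) ⟨
    count a (map (λ z → n * z + w % n) (applyUpTo h m))
      ≡⟨ count-radix a (m%n<n w n) (applyUpTo h m) ⟩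
    δ (a % n) (w % n) * count (a / n) (applyUpTo h m)
      ≡⟨ cong (δ (a % n) (w % n) *_) (count-applyUpTo-bijection m h h-inj (λ _ → m%n<n _ m) (a / n) a/n<m) ⟩
    δ (a % n) (w % n) * 1
      ≡⟨ *-identityʳ _ ⟩
    δ (a % n) (w % n)
      ∎
    where
    open ≡-Reasoning
    h : ℕ → ℕ
    h i = (g i + w / n) % m
    v≡radix : ∀ {i} → i < m → v i ≡ n * h i + w % n
    v≡radix {i} i<m = begin
      v i
        ≡⟨ v≡ i<m ⟩
      (n * g i + w) % (n * m)
        ≡⟨ cong (λ u → (n * g i + u) % (n * m)) (n*[a/n]+a%n≡a w) ⟨
      (n * g i + (n * (w / n) + w % n)) % (n * m)
        ≡⟨ cong (_% (n * m)) (n*a+[n*b+c]≡n*[a+b]+c (g i) (w / n) (w % n)) ⟩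
      (n * (g i + w / n) + w % n) % (n * m)
        ≡⟨ [n*z+r]%nm (g i + w / n) (m%n<n w n) ⟩
      n * h i + w % n
        ∎
    h-inj : InjectiveOn m h
    h-inj i<m j<m hi≡hj = g-inj i<m j<m (%-+-cancelʳ m (w / n) hi≡hj)
    a/n<m : a / n < m
    a/n<m = m<n*o⇒m/o<n (subst (a <_) (*-comm n m) a<nm)

  [n*z]%nm : ∀ z → (n * z) % (n * m) ≡ n * (z % m)
  [n*z]%nm z = ≡-trans (cong (_% (n * m)) (sym (+-identityʳ (n * z))))
                       (≡-trans ([n*z+r]%nm z (>-nonZero⁻¹ n)) (+-identityʳ (n * (z % m))))

  n*z+r<nm : ∀ {z r} → z < m → r < n → n * z + r < n * m
  n*z+r<nm {z} {r} z<m r<n = begin-strict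
    n * z + r      <⟨ +-monoʳ-< (n * z) r<n ⟩
    n * z + n      ≡⟨ ≡-trans (+-comm (n * z) n) (sym (*-suc n z)) ⟩
    n * suc z      ≤⟨ *-monoʳ-≤ n z<m ⟩
    n * m          ∎
    where open ≤-Reasoning

  n*z+r+complement≡nm : ∀ {z r} → z < m → r ≤ n → n * z + r + (n * (m ∸ suc z) + (n ∸ r)) ≡ n * m
  n*z+r+complement≡nm {z} {r} z<m r≤n = begin
    n * z + r + (n * (m ∸ suc z) + (n ∸ r))
      ≡⟨ interchange (n * z) r _ _ ⟩
    n * z + n * (m ∸ suc z) + (r + (n ∸ r))
      ≡⟨ cong (n * z + n * (m ∸ suc z) +_) (m+[n∸m]≡n r≤n) ⟩
    n * z + n * (m ∸ suc z) + n
      ≡⟨ solve 3 (λ n z d → n :* z :+ n :* d :+ n := n :* (con 1 :+ z :+ d)) refl n z (m ∸ suc z) ⟩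
    n * (suc z + (m ∸ suc z))
      ≡⟨ cong (n *_) (m+[n∸m]≡n z<m) ⟩
    n * m
      ∎
    where open ≡-Reasoning

  nm∸[n*z+r] : ∀ {z r} → z < m → r ≤ n → n * m ∸ (n * z + r) ≡ n * (m ∸ suc z) + (n ∸ r)
  nm∸[n*z+r] {z} {r} z<m r≤n =
    ≡-trans (cong (_∸ (n * z + r)) (sym (n*z+r+complement≡nm z<m r≤n))) (m+n∸m≡n (n * z + r) _)

  n*z+r+nm∸[n*z′+r′] : ∀ z r {z′ r′} → z′ < m → r′ ≤ n →
                       n * z + r + n * m ∸ (n * z′ + r′) ≡ n * (z + (m ∸ suc z′)) + (r + (n ∸ r′))
  n*z+r+nm∸[n*z′+r′] z r {z′} {r′} z′<m r′≤n = begin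
    n * z + r + n * m ∸ (n * z′ + r′)
      ≡⟨ +-∸-assoc (n * z + r) n*z′+r′≤nm ⟩
    n * z + r + (n * m ∸ (n * z′ + r′))
      ≡⟨ cong (n * z + r +_) (nm∸[n*z+r] z′<m r′≤n) ⟩
    n * z + r + (n * (m ∸ suc z′) + (n ∸ r′))
      ≡⟨ solve 5 (λ n z r d e → n :* z :+ r :+ (n :* d :+ e) := n :* (z :+ d) :+ (r :+ e))
                 refl n z r (m ∸ suc z′) (n ∸ r′) ⟩
    n * (z + (m ∸ suc z′)) + (r + (n ∸ r′))
      ∎
    where
    open ≡-Reasoning
    n*z′+r′≤nm : n * z′ + r′ ≤ n * m
    n*z′+r′≤nm = ≤-trans (m≤m+n (n * z′ + r′) _) (≤-reflexive (n*z+r+complement≡nm z′<m r′≤n))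

  count-n* : ∀ a zs → count a (map (n *_) zs) ≡ δ (a % n) 0 * count (a / n) zs
  count-n* a zs = ≡-trans (cong (count a) (map-cong (λ z → sym (+-identityʳ (n * z))) zs))
                          (count-radix a (>-nonZero⁻¹ n) zs)

  count-Zstar-radix : ∀ a → a < n * m →
                      count (a % n) (Zstar n) + δ (a % n) 0 * count (a / n) (Zstar m) ≡ count a (Zstar (n * m))
  count-Zstar-radix a a<nm = digits (a / n) (a % n) (n*[a/n]+a%n≡a a) (m%n<n a n) (m<n*o⇒m/o<n (subst (a <_) (*-comm n m) a<nm))
    where
    digits : ∀ q r → n * q + r ≡ a → r < n → q < m →
             count r (Zstar n) + δ r 0 * count q (Zstar m) ≡ count a (Zstar (n * m))
    digits zero    zero    n*0+0≡a _   _   = begin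
      count 0 (Zstar n) + 1 * count 0 (Zstar m)  ≡⟨ cong₂ (λ u v → u + 1 * v) (count-Zstar-zero n) (count-Zstar-zero m) ⟩
      0                                          ≡⟨ count-Zstar-zero (n * m) ⟨
      count 0 (Zstar (n * m))                    ≡⟨ cong (λ b → count b (Zstar (n * m))) 0≡a ⟩
      count a (Zstar (n * m))                    ∎
      where
      open ≡-Reasoning
      0≡a : 0 ≡ a
      0≡a = ≡-trans (sym (≡-trans (+-identityʳ (n * 0)) (*-zeroʳ n))) n*0+0≡a
    digits (suc q) zero    n*q+0≡a _   q<m = begin
      count 0 (Zstar n) + 1 * count (suc q) (Zstar m)
        ≡⟨ cong₂ (λ u v → u + 1 * v) (count-Zstar-zero n) (count-Zstar z<s q<m) ⟩
      1
        ≡⟨ count-Zstar (subst (0 <_) n*q+0≡a positive) a<nm ⟨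
      count a (Zstar (n * m))
        ∎
      where
      open ≡-Reasoning
      positive : 0 < n * suc q + 0
      positive = <-≤-trans (>-nonZero⁻¹ n)
        (≤-trans (m≤m+n n (n * q)) (≤-trans (≤-reflexive (sym (*-suc n q))) (m≤m+n (n * suc q) 0)))
    digits q       (suc r) n*q+r≡a r<n _   = begin
      count (suc r) (Zstar n) + 0         ≡⟨ +-identityʳ _ ⟩
      count (suc r) (Zstar n)             ≡⟨ count-Zstar z<s r<n ⟩
      1                                   ≡⟨ count-Zstar (subst (0 <_) n*q+r≡a (<-≤-trans z<s (m≤n+m (suc r) (n * q)))) a<nm ⟨
      count a (Zstar (n * m))             ∎
      where open ≡-Reasoning

-- Distances in odd moduli

∣a+b-c+d∣≤∣a-c∣+∣b-d∣ : ∀ a b c d → ∣ a + b - c + d ∣ ≤ ∣ a - c ∣ + ∣ b - d ∣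
∣a+b-c+d∣≤∣a-c∣+∣b-d∣ a b c d = begin
  ∣ a + b - c + d ∣                      ≤⟨ ∣-∣-triangle (a + b) (c + b) (c + d) ⟩
  ∣ a + b - c + b ∣ + ∣ c + b - c + d ∣   ≡⟨ cong (_+ ∣ c + b - c + d ∣) (cong₂ ∣_-_∣ (+-comm a b) (+-comm c b)) ⟩
  ∣ b + a - b + c ∣ + ∣ c + b - c + d ∣   ≡⟨ cong₂ _+_ (∣m+n-m+o∣≡∣n-o∣ b a c) (∣m+n-m+o∣≡∣n-o∣ c b d) ⟩
  ∣ a - c ∣ + ∣ b - d ∣                   ∎
  where open ≤-Reasoning

odd⇒≡1+2*[/2] : ∀ m → m % 2 ≡ 1 → m ≡ 1 + 2 * (m / 2)
odd⇒≡1+2*[/2] m m-odd = ≡-trans (m≡m%n+[m/n]*n m 2) (cong₂ _+_ m-odd (*-comm (m / 2) 2))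

odd*odd/2 : ∀ n m → n % 2 ≡ 1 → m % 2 ≡ 1 → (n * m) / 2 ≡ n * (m / 2) + n / 2
odd*odd/2 n m _ m-odd = begin
  (n * m) / 2                    ≡⟨ /-congˡ (cong (n *_) (odd⇒≡1+2*[/2] m m-odd)) ⟩
  (n * (1 + 2 * (m / 2))) / 2
    ≡⟨ /-congˡ (solve 2 (λ n p → n :* (con 1 :+ con 2 :* p) := n :+ n :* p :* con 2) refl n (m / 2)) ⟩
  (n + n * (m / 2) * 2) / 2      ≡⟨ +-distrib-/-∣ʳ n (divides (n * (m / 2)) refl) ⟩
  n / 2 + n * (m / 2) * 2 / 2    ≡⟨ cong (n / 2 +_) (m*n/n≡m (n * (m / 2)) 2) ⟩
  n / 2 + n * (m / 2)            ≡⟨ +-comm (n / 2) _ ⟩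
  n * (m / 2) + n / 2            ∎
  where open ≡-Reasoning

2*i≡t+c⇒∣i-t∣≡∣c-i∣ : ∀ i t c → 2 * i ≡ t + c → ∣ i - t ∣ ≡ ∣ c - i ∣
2*i≡t+c⇒∣i-t∣≡∣c-i∣ i t c 2i≡t+c = begin
  ∣ i - t ∣               ≡⟨ ∣m+n-m+o∣≡∣n-o∣ i i t ⟨
  ∣ i + i - i + t ∣       ≡⟨ cong₂ ∣_-_∣ (≡-trans (cong (i +_) (sym (+-identityʳ i))) 2i≡t+c) (+-comm i t) ⟩
  ∣ t + c - t + i ∣       ≡⟨ ∣m+n-m+o∣≡∣n-o∣ t c i ⟩
  ∣ c - i ∣               ∎
  where open ≡-Reasoning

∣i-[2*i]%m∣≤m/2 : ∀ {m} .{{_ : NonZero m}} → m % 2 ≡ 1 → ∀ {i} → i < m → ∣ i - (2 * i) % m ∣ ≤ m / 2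
∣i-[2*i]%m∣≤m/2 {m} m-odd {i} i<m with 2 * i <? m
... | yes 2i<m = begin
  ∣ i - (2 * i) % m ∣   ≡⟨ 2*i≡t+c⇒∣i-t∣≡∣c-i∣ i ((2 * i) % m) 0 2i≡t+0 ⟩
  ∣ 0 - i ∣             ≡⟨ ∣-∣-identityˡ i ⟩
  i                     ≤⟨ *-cancelˡ-≤ 2 (≤-pred (subst (2 * i <_) (odd⇒≡1+2*[/2] m m-odd) 2i<m)) ⟩
  m / 2                 ∎
  where
  open ≤-Reasoning
  2i≡t+0 : 2 * i ≡ (2 * i) % m + 0
  2i≡t+0 = ≡-trans (sym (m<n⇒m%n≡m 2i<m)) (sym (+-identityʳ _))
... | no 2i≮m = begin
  ∣ i - (2 * i) % m ∣   ≡⟨ 2*i≡t+c⇒∣i-t∣≡∣c-i∣ i ((2 * i) % m) m 2i≡t+m ⟩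
  ∣ m - i ∣             ≡⟨ m≤n⇒∣n-m∣≡n∸m (<⇒≤ i<m) ⟩
  m ∸ i                 ≤⟨ ∸-monoʳ-≤ m p<i ⟩
  m ∸ suc (m / 2)       ≡⟨ cong (_∸ suc (m / 2)) (odd⇒≡1+2*[/2] m m-odd) ⟩
  2 * (m / 2) ∸ m / 2   ≡⟨ m+n∸m≡n (m / 2) (m / 2 + 0) ⟩
  m / 2 + 0             ≡⟨ +-identityʳ (m / 2) ⟩
  m / 2                 ∎
  where
  open ≤-Reasoning
  m≤2i : m ≤ 2 * i
  m≤2i = ≮⇒≥ 2i≮m
  [2i∸m]%m≡2i∸m : (2 * i ∸ m) % m ≡ 2 * i ∸ m
  [2i∸m]%m≡2i∸m = m<n⇒m%n≡m (m<n+o⇒m∸n<o (2 * i) m (+-mono-< i<m (subst (_< m) (sym (+-identityʳ i)) i<m)))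
  2i≡t+m : 2 * i ≡ (2 * i) % m + m
  2i≡t+m = ≡-trans (sym (m∸n+n≡m m≤2i)) (cong (_+ m) (≡-trans (sym [2i∸m]%m≡2i∸m) (m≤n⇒[n∸m]%m≡n%m m≤2i)))
  p<i : suc (m / 2) ≤ i
  p<i = *-cancelˡ-< 2 (m / 2) i (<-≤-trans (subst (2 * (m / 2) <_) (sym (odd⇒≡1+2*[/2] m m-odd)) (n<1+n _)) m≤2i)

-- Statistics of pairs

Statistic : Set
Statistic = ℕ → ℕ → ℕ → ℕ

stat : Statistic → ℕ → ℕ × ℕ → ℕ
stat F k (x , y) = F k x y

tally₂ : Statistic → Statistic → ℕ → Pairs → List ℕ
tally₂ F G k = concatMap (λ p → stat F k p ∷ stat G k p ∷ [])

left right difˡ difʳ sum⁺ sum⁻ : Statistic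
left  k x y = x
right k x y = y
difˡ  k x y = dif k x y
difʳ  k x y = dif k y x
sum⁺  k x y = sm k x y
sum⁻  k x y = negsm k x y

count-tally₂ : ∀ F G k a P → count a (tally₂ F G k P) ≡ count a (map (stat F k) P) + count a (map (stat G k) P)
count-tally₂ F G k a []      = refl
count-tally₂ F G k a (p ∷ P) = begin
  δ a (stat F k p) + (δ a (stat G k p) + count a (tally₂ F G k P))
    ≡⟨ cong (λ c → δ a (stat F k p) + (δ a (stat G k p) + c)) (count-tally₂ F G k a P) ⟩
  δ a (stat F k p) + (δ a (stat G k p) + (count a (map (stat F k) P) + count a (map (stat G k) P)))
    ≡⟨ cong (δ a (stat F k p) +_) (x∙yz≈y∙xz (δ a (stat G k p)) (count a (map (stat F k) P)) _) ⟩
  δ a (stat F k p) + (count a (map (stat F k) P) + (δ a (stat G k p) + count a (map (stat G k) P)))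
    ≡⟨ +-assoc (δ a (stat F k p)) _ _ ⟨
  count a (map (stat F k) (p ∷ P)) + count a (map (stat G k) (p ∷ P))
    ∎
  where open ≡-Reasoning

StatisticBelow : Statistic → Set
StatisticBelow F = ∀ {k a b} → a < k → b < k → F k a b < k

map-stat-below : ∀ {F k P} → StatisticBelow F → All (PairBelow k) P → All (_< k) (map (stat F k) P)
map-stat-below F-below P<k = Allₚ.map⁺ (All.map (λ { (x<k , y<k) → F-below x<k y<k }) P<k)

tally₂-below : ∀ {F G k P} → StatisticBelow F → StatisticBelow G → All (PairBelow k) P → All (_< k) (tally₂ F G k P)
tally₂-below F-below G-below []                = []
tally₂-below F-below G-below ((x<k , y<k) ∷ P<k) = F-below x<k y<k ∷ G-below x<k y<k ∷ tally₂-below F-below G-below P<k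

left-below : StatisticBelow left
left-below x<k _ = x<k

right-below : StatisticBelow right
right-below _ y<k = y<k

difˡ-below : StatisticBelow difˡ
difˡ-below {suc k} {a} {b} _ _ = m%n<n (a + suc k ∸ b) (suc k)

difʳ-below : StatisticBelow difʳ
difʳ-below {suc k} {a} {b} _ _ = m%n<n (b + suc k ∸ a) (suc k)

sum⁺-below : StatisticBelow sum⁺
sum⁺-below {suc k} {a} {b} _ _ = m%n<n (a + b) (suc k)

sum⁻-below : StatisticBelow sum⁻
sum⁻-below {suc k} {a} {b} _ _ = m%n<n (suc k ∸ sm (suc k) a b) (suc k)

-- The cardioidal product

module Cardioid (n₀ m₀ : ℕ) where

  n m N : ℕ
  n = suc n₀
  m = suc m₀
  N = n * m

  open Radix n m

  twice : ℕ → ℕ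
  twice i = (2 * i) % m

  twice<m : ∀ i → twice i < m
  twice<m i = m%n<n (2 * i) m

  lift : ℕ → ℕ → ℕ × ℕ → ℕ × ℕ
  lift x y (r , t) = ((n * r + x) mod N , (n * t + y) mod N)

  column : ℕ → ℕ → ℕ → ℕ × ℕ
  column x y i = lift x y (i , twice i)

  block : ℕ × ℕ → Pairs
  block (x , y) = map (lift x y) ((0 , 0) ∷ Cm m)

  scaled : ℕ × ℕ → ℕ × ℕ
  scaled (r , t) = ((n * r) mod N , (n * t) mod N)

  block≡ : ∀ x y → block (x , y) ≡ applyUpTo (column x y) m
  block≡ x y = cong (column x y 0 ∷_) (begin
    map (lift x y) (map (λ i → (i , (2 * i) mod m)) (map suc (upTo m₀))) ≡⟨ cong (map (lift x y)) (map-∘ (upTo m₀)) ⟨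
    map (lift x y) (map (λ i → (suc i , twice (suc i))) (upTo m₀))        ≡⟨ map-∘ (upTo m₀) ⟨
    map (column x y ∘ suc) (upTo m₀)                                      ≡⟨ map-upTo (column x y ∘ suc) m₀ ⟩
    applyUpTo (column x y ∘ suc) m₀                                       ∎)
    where open ≡-Reasoning

  column≡ : ∀ {x y i} → x < n → y < n → i < m → column x y i ≡ (n * i + x , n * twice i + y)
  column≡ {i = i} x<n y<n i<m =
    cong₂ _,_ (m<n⇒m%n≡m (n*z+r<nm i<m x<n)) (m<n⇒m%n≡m (n*z+r<nm (twice<m i) y<n))

  -- For left, right, difˡ, difʳ, sum⁺ and sum⁻ the values on a column are n * g i + w with
  -- g i ≡ i, 2i, −i − 1, i − 1, 3i and −3i − 1 − (x + y) / n (mod m) respectively.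
  ColumnLifting : Statistic → Set
  ColumnLifting F = ∀ {x y} → x < n → y < n → ∀ a → a < N →
                    count a (applyUpTo (stat F N ∘ column x y) m) ≡ δ (a % n) (F n x y)

  m⊥1 : Coprime m 1
  m⊥1 = Coprime.sym (1-coprimeTo m)

  left-lifts : ColumnLifting left
  left-lifts {x} x<n _ a a<N = ≡-trans
    (count-column _ (λ i → i) x (λ _ → refl) (affine-injectiveOn m 0 (λ i → i) m⊥1 (λ _ → refl)) a a<N)
    (cong (δ (a % n)) (m<n⇒m%n≡m x<n))

  right-lifts : Coprime m 2 → ColumnLifting right
  right-lifts m⊥2 {y = y} _ y<n a a<N = ≡-trans
    (count-column _ twice y (λ _ → refl) (affine-injectiveOn m 0 twice m⊥2 twice≡2*) a a<N)
    (cong (δ (a % n)) (m<n⇒m%n≡m y<n))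
    where
    twice≡2* : ∀ {i} → i < m → (twice i + 0) % m ≡ (2 * i) % m
    twice≡2* {i} _ = ≡-trans (cong (_% m) (+-identityʳ (twice i))) (m%n%n≡m%n (2 * i) m)

  difˡ-lifts : ColumnLifting difˡ
  difˡ-lifts {x} {y} x<n y<n a a<N = ≡-trans
    (count-column _ g (x + (n ∸ y)) values (antiaffine-injectiveOn m 1 g m⊥1 g+i+1≡0) a a<N)
    (cong (λ w → δ (a % n) (w % n)) (sym (+-∸-assoc x (<⇒≤ y<n))))
    where
    g : ℕ → ℕ
    g i = i + (m ∸ suc (twice i))
    values : ∀ {i} → i < m → stat difˡ N (column x y i) ≡ (n * g i + (x + (n ∸ y))) % N
    values {i} i<m = ≡-trans (cong (stat difˡ N) (column≡ x<n y<n i<m))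
                             (cong (_% N) (n*z+r+nm∸[n*z′+r′] i x (twice<m i) (<⇒≤ y<n)))
    g+i+1≡0 : ∀ {i} → i < m → (g i + 1 * i + 1) % m ≡ 0
    g+i+1≡0 {i} _ = %-+-cancelʳ m (twice i) {g i + 1 * i + 1} {0} (begin
      (g i + 1 * i + 1 + twice i) % m
        ≡⟨ cong (_% m) (solve 3 (λ i d t → i :+ d :+ con 1 :* i :+ con 1 :+ t := con 2 :* i :+ (d :+ (con 1 :+ t)))
                                refl i (m ∸ suc (twice i)) (twice i)) ⟩
      (2 * i + (m ∸ suc (twice i) + suc (twice i))) % m
        ≡⟨ cong (λ u → (2 * i + u) % m) (m∸n+n≡m (twice<m i)) ⟩
      (2 * i + m) % m
        ≡⟨ [m+n]%n≡m%n (2 * i) m ⟩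
      (2 * i) % m
        ≡⟨ m%n%n≡m%n (2 * i) m ⟨
      twice i % m
        ∎)
      where open ≡-Reasoning

  difʳ-lifts : ColumnLifting difʳ
  difʳ-lifts {x} {y} x<n y<n a a<N = ≡-trans
    (count-column _ g (y + (n ∸ x)) values (affine-injectiveOn m 1 g m⊥1 g+1≡i) a a<N)
    (cong (λ w → δ (a % n) (w % n)) (sym (+-∸-assoc y (<⇒≤ x<n))))
    where
    g : ℕ → ℕ
    g i = twice i + (m ∸ suc i)
    values : ∀ {i} → i < m → stat difʳ N (column x y i) ≡ (n * g i + (y + (n ∸ x))) % N
    values {i} i<m = ≡-trans (cong (stat difʳ N) (column≡ x<n y<n i<m))
                             (cong (_% N) (n*z+r+nm∸[n*z′+r′] (twice i) y i<m (<⇒≤ x<n)))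
    g+1≡i : ∀ {i} → i < m → (g i + 1) % m ≡ (1 * i) % m
    g+1≡i {i} i<m = %-+-cancelʳ m i {g i + 1} {1 * i} (begin
      (g i + 1 + i) % m                        ≡⟨ cong (_% m) (+-assoc (twice i + (m ∸ suc i)) 1 i) ⟩
      (twice i + (m ∸ suc i) + suc i) % m      ≡⟨ cong (_% m) (+-assoc (twice i) (m ∸ suc i) (suc i)) ⟩
      (twice i + (m ∸ suc i + suc i)) % m      ≡⟨ cong (λ u → (twice i + u) % m) (m∸n+n≡m i<m) ⟩
      (twice i + m) % m                        ≡⟨ [m+n]%n≡m%n (twice i) m ⟩
      twice i % m                              ≡⟨ m%n%n≡m%n (2 * i) m ⟩
      (2 * i) % m                              ≡⟨ cong (_% m) (solve 1 (λ i → con 2 :* i := con 1 :* i :+ i) refl i) ⟩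
      (1 * i + i) % m                          ∎)
      where open ≡-Reasoning

  sum-column : ∀ {x y i} → x < n → y < n → i < m → stat sum⁺ N (column x y i) ≡ (n * (i + twice i) + (x + y)) % N
  sum-column {x} {y} {i} x<n y<n i<m = ≡-trans (cong (stat sum⁺ N) (column≡ x<n y<n i<m)) (cong (_% N)
    (solve 5 (λ n i t x y → n :* i :+ x :+ (n :* t :+ y) := n :* (i :+ t) :+ (x :+ y)) refl n i (twice i) x y))

  sum⁺-lifts : Coprime m 3 → ColumnLifting sum⁺
  sum⁺-lifts m⊥3 {x} {y} x<n y<n = count-column _ g (x + y) (sum-column x<n y<n) (affine-injectiveOn m 0 g m⊥3 g≡3i)
    where
    g : ℕ → ℕ
    g i = i + twice i
    g≡3i : ∀ {i} → i < m → (g i + 0) % m ≡ (3 * i) % m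
    g≡3i {i} _ = begin
      (i + twice i + 0) % m   ≡⟨ cong (_% m) (+-identityʳ (g i)) ⟩
      (i + twice i) % m       ≡⟨ %-+-congˡ m i (m%n%n≡m%n (2 * i) m) ⟩
      (i + 2 * i) % m         ≡⟨ cong (_% m) (solve 1 (λ i → i :+ con 2 :* i := con 3 :* i) refl i) ⟩
      (3 * i) % m             ∎
      where open ≡-Reasoning

  sum-column-digits : ∀ {x y i} → x < n → y < n → i < m →
                      stat sum⁺ N (column x y i) ≡ n * ((i + twice i + (x + y) / n) % m) + (x + y) % n
  sum-column-digits {x} {y} {i} x<n y<n i<m = begin
    stat sum⁺ N (column x y i)                      ≡⟨ sum-column x<n y<n i<m ⟩
    (n * (i + twice i) + (x + y)) % N               ≡⟨ cong (λ u → (n * (i + twice i) + u) % N) (n*[a/n]+a%n≡a (x + y)) ⟨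
    (n * (i + twice i) + (n * q + s)) % N           ≡⟨ cong (_% N) (n*a+[n*b+c]≡n*[a+b]+c (i + twice i) q s) ⟩
    (n * (i + twice i + q) + s) % N                 ≡⟨ [n*z+r]%nm (i + twice i + q) (m%n<n (x + y) n) ⟩
    n * ((i + twice i + q) % m) + s                 ∎
    where
    open ≡-Reasoning
    q s : ℕ
    q = (x + y) / n
    s = (x + y) % n

  sum⁻-lifts : Coprime m 3 → ColumnLifting sum⁻
  sum⁻-lifts m⊥3 {x} {y} x<n y<n = count-column _ g (n ∸ s) values (antiaffine-injectiveOn m (1 + q) g m⊥3 g+3i+1+q≡0)
    where
    q s : ℕ
    q = (x + y) / n
    s = (x + y) % n
    G g : ℕ → ℕ
    G i = (i + twice i + q) % m
    g i = m ∸ suc (G i)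
    values : ∀ {i} → i < m → stat sum⁻ N (column x y i) ≡ (n * g i + (n ∸ s)) % N
    values {i} i<m = cong (_% N)
      (≡-trans (cong (N ∸_) (sum-column-digits x<n y<n i<m)) (nm∸[n*z+r] (m%n<n (i + twice i + q) m) (m%n≤n (x + y) n)))
    g+3i+1+q≡0 : ∀ {i} → i < m → (g i + 3 * i + (1 + q)) % m ≡ 0
    g+3i+1+q≡0 {i} _ = begin
      (g i + 3 * i + (1 + q)) % m
        ≡⟨ cong (_% m) (solve 3 (λ g i q → g :+ con 3 :* i :+ (con 1 :+ q) := g :+ con 1 :+ (i :+ con 2 :* i :+ q))
                                refl (g i) i q) ⟩
      (g i + 1 + (i + 2 * i + q)) % m
        ≡⟨ %-+-congˡ m (g i + 1) 3i+q≡G ⟩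
      (g i + 1 + G i) % m
        ≡⟨ cong (_% m) (≡-trans (+-assoc (g i) 1 (G i)) (m∸n+n≡m (m%n<n (i + twice i + q) m))) ⟩
      m % m
        ≡⟨ n%n≡0 m ⟩
      0
        ∎
      where
      open ≡-Reasoning
      3i+q≡G : (i + 2 * i + q) % m ≡ G i % m
      3i+q≡G = ≡-trans (%-+-congʳ m q {i + 2 * i} {i + twice i} (%-+-congˡ m i {2 * i} {twice i} 2i≡twice))
                       (sym (m%n%n≡m%n (i + twice i + q) m))
        where
        2i≡twice : (2 * i) % m ≡ twice i % m
        2i≡twice = sym (m%n%n≡m%n (2 * i) m)

  Scaling : Statistic → Set
  Scaling F = ∀ {r t} → r < m → t < m → stat F N (scaled (r , t)) ≡ n * F m r t

  [n*z]%N≡n*z : ∀ {z} → z < m → (n * z) % N ≡ n * z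
  [n*z]%N≡n*z {z} z<m = m<n⇒m%n≡m (subst (_< N) (+-identityʳ (n * z)) (n*z+r<nm z<m (>-nonZero⁻¹ n)))

  scaled≡ : ∀ {r t} → r < m → t < m → scaled (r , t) ≡ (n * r , n * t)
  scaled≡ r<m t<m = cong₂ _,_ ([n*z]%N≡n*z r<m) ([n*z]%N≡n*z t<m)

  n*a+nm∸n*b : ∀ a b → n * a + N ∸ n * b ≡ n * (a + m ∸ b)
  n*a+nm∸n*b a b = ≡-trans (cong (_∸ n * b) (sym (*-distribˡ-+ n a m))) (sym (*-distribˡ-∸ n (a + m) b))

  left-scales : Scaling left
  left-scales r<m _ = [n*z]%N≡n*z r<m

  right-scales : Scaling right
  right-scales _ t<m = [n*z]%N≡n*z t<m

  difˡ-scales : Scaling difˡ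
  difˡ-scales {r} {t} r<m t<m = ≡-trans (cong (stat difˡ N) (scaled≡ r<m t<m))
    (≡-trans (cong (_% N) (n*a+nm∸n*b r t)) ([n*z]%nm (r + m ∸ t)))

  difʳ-scales : Scaling difʳ
  difʳ-scales {r} {t} r<m t<m = ≡-trans (cong (stat difʳ N) (scaled≡ r<m t<m))
    (≡-trans (cong (_% N) (n*a+nm∸n*b t r)) ([n*z]%nm (t + m ∸ r)))

  sum⁺-scales : Scaling sum⁺
  sum⁺-scales {r} {t} r<m t<m = ≡-trans (cong (stat sum⁺ N) (scaled≡ r<m t<m))
    (≡-trans (cong (_% N) (sym (*-distribˡ-+ n r t))) ([n*z]%nm (r + t)))

  sum⁻-scales : Scaling sum⁻
  sum⁻-scales {r} {t} r<m t<m = begin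
    (N ∸ stat sum⁺ N (scaled (r , t))) % N   ≡⟨ cong (λ u → (N ∸ u) % N) (sum⁺-scales r<m t<m) ⟩
    (N ∸ n * ((r + t) % m)) % N             ≡⟨ cong (_% N) (*-distribˡ-∸ n m ((r + t) % m)) ⟨
    (n * (m ∸ (r + t) % m)) % N             ≡⟨ [n*z]%nm (m ∸ (r + t) % m) ⟩
    n * ((m ∸ (r + t) % m) % m)             ∎
    where open ≡-Reasoning

  lift-below : ∀ x y p → PairBelow N (lift x y p)
  lift-below x y (r , t) = m%n<n (n * r + x) N , m%n<n (n * t + y) N

  scaled-below : ∀ p → PairBelow N (scaled p)
  scaled-below (r , t) = m%n<n (n * r) N , m%n<n (n * t) N

  cardioidal-below : ∀ S T → All (PairBelow N) (cardioidal n m S T)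
  cardioidal-below S T = Allₚ.++⁺ (blocks-below S) (Allₚ.map⁺ (All.universal scaled-below T))
    where
    blocks-below : ∀ S → All (PairBelow N) (concatMap block S)
    blocks-below []            = []
    blocks-below ((x , y) ∷ S) = Allₚ.++⁺ (Allₚ.map⁺ (All.universal (lift-below x y) ((0 , 0) ∷ Cm m))) (blocks-below S)

  Splits : (ℕ → Pairs → List ℕ) → Pairs → Pairs → Set
  Splits f S T = ∀ a → a < N →
    count a (f N (cardioidal n m S T)) ≡ count (a % n) (f n S) + δ (a % n) 0 * count (a / n) (f m T)

  count-blocks : ∀ F → ColumnLifting F → ∀ {S} → All (PairBelow n) S → ∀ a → a < N →
                 count a (map (stat F N) (concatMap block S)) ≡ count (a % n) (map (stat F n) S)
  count-blocks F F-lifts []                               a a<N = refl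
  count-blocks F F-lifts {(x , y) ∷ S} ((x<n , y<n) ∷ S<n) a a<N = begin
    count a (map (stat F N) (block (x , y) ++ concatMap block S))
      ≡⟨ cong (count a) (map-++ (stat F N) (block (x , y)) _) ⟩
    count a (map (stat F N) (block (x , y)) ++ map (stat F N) (concatMap block S))
      ≡⟨ count-++ a (map (stat F N) (block (x , y))) _ ⟩
    count a (map (stat F N) (block (x , y))) + count a (map (stat F N) (concatMap block S))
      ≡⟨ cong (λ ps → count a (map (stat F N) ps) + rest) (block≡ x y) ⟩
    count a (map (stat F N) (applyUpTo (column x y) m)) + count a (map (stat F N) (concatMap block S))
      ≡⟨ cong (λ vs → count a vs + rest) (map-applyUpTo (column x y) (stat F N) m) ⟩
    count a (applyUpTo (stat F N ∘ column x y) m) + count a (map (stat F N) (concatMap block S))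
      ≡⟨ cong₂ _+_ (F-lifts x<n y<n a a<N) (count-blocks F F-lifts S<n a a<N) ⟩
    δ (a % n) (F n x y) + count (a % n) (map (stat F n) S)
      ∎
    where
    open ≡-Reasoning
    rest : ℕ
    rest = count a (map (stat F N) (concatMap block S))

  map-scaled : ∀ F → Scaling F → ∀ {T} → All (PairBelow m) T →
               map (stat F N) (map scaled T) ≡ map (n *_) (map (stat F m) T)
  map-scaled F F-scales []                  = refl
  map-scaled F F-scales ((r<m , t<m) ∷ T<m) = cong₂ _∷_ (F-scales r<m t<m) (map-scaled F F-scales T<m)

  stat-splits : ∀ F {S T} → ColumnLifting F → Scaling F → All (PairBelow n) S → All (PairBelow m) T →
                Splits (λ k → map (stat F k)) S T
  stat-splits F {S} {T} F-lifts F-scales S<n T<m a a<N = begin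
    count a (map (stat F N) (concatMap block S ++ map scaled T))
      ≡⟨ cong (count a) (map-++ (stat F N) (concatMap block S) _) ⟩
    count a (map (stat F N) (concatMap block S) ++ map (stat F N) (map scaled T))
      ≡⟨ count-++ a (map (stat F N) (concatMap block S)) _ ⟩
    count a (map (stat F N) (concatMap block S)) + count a (map (stat F N) (map scaled T))
      ≡⟨ cong₂ _+_ (count-blocks F F-lifts S<n a a<N) (cong (count a) (map-scaled F F-scales T<m)) ⟩
    count (a % n) (map (stat F n) S) + count a (map (n *_) (map (stat F m) T))
      ≡⟨ cong (count (a % n) (map (stat F n) S) +_) (count-n* a (map (stat F m) T)) ⟩
    count (a % n) (map (stat F n) S) + δ (a % n) 0 * count (a / n) (map (stat F m) T)
      ∎
    where open ≡-Reasoning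

  tally₂-splits : ∀ F G {S T} → Splits (λ k → map (stat F k)) S T → Splits (λ k → map (stat G k)) S T →
                  Splits (tally₂ F G) S T
  tally₂-splits F G {S} {T} F-splits G-splits a a<N = begin
    count a (tally₂ F G N (cardioidal n m S T))
      ≡⟨ count-tally₂ F G N a (cardioidal n m S T) ⟩
    count a (map (stat F N) (cardioidal n m S T)) + count a (map (stat G N) (cardioidal n m S T))
      ≡⟨ cong₂ _+_ (F-splits a a<N) (G-splits a a<N) ⟩
    (sF + d * tF) + (sG + d * tG)
      ≡⟨ interchange sF (d * tF) sG (d * tG) ⟩
    (sF + sG) + (d * tF + d * tG)
      ≡⟨ cong₂ _+_ (count-tally₂ F G n (a % n) S) (*-distribˡ-+ d tF tG) ⟨
    count (a % n) (tally₂ F G n S) + d * (tF + tG)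
      ≡⟨ cong (λ c → count (a % n) (tally₂ F G n S) + d * c) (count-tally₂ F G m (a / n) T) ⟨
    count (a % n) (tally₂ F G n S) + d * count (a / n) (tally₂ F G m T)
      ∎
    where
    open ≡-Reasoning
    d sF sG tF tG : ℕ
    d  = δ (a % n) 0
    sF = count (a % n) (map (stat F n) S)
    sG = count (a % n) (map (stat G n) S)
    tF = count (a / n) (map (stat F m) T)
    tG = count (a / n) (map (stat G m) T)

  splits⇒↭ : ∀ f {S T} → Splits f S T → All (_< N) (f N (cardioidal n m S T)) →
             f n S ↭ Zstar n → f m T ↭ Zstar m → f N (cardioidal n m S T) ↭ Zstar N
  splits⇒↭ f {S} {T} f-splits W<N S↭ T↭ = count≡⇒↭ _ _ counts
    where
    counts : ∀ a → count a (f N (cardioidal n m S T)) ≡ count a (Zstar N)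
    counts a with a <? N
    ... | no a≮N  = ≡-trans (All<⇒count≡0 W<N (≮⇒≥ a≮N)) (sym (All<⇒count≡0 (Zstar-bounded N) (≮⇒≥ a≮N)))
    ... | yes a<N = begin
      count a (f N (cardioidal n m S T))                              ≡⟨ f-splits a a<N ⟩
      count (a % n) (f n S) + δ (a % n) 0 * count (a / n) (f m T)     ≡⟨ cong₂ (λ u v → u + δ (a % n) 0 * v)
                                                                           (↭⇒count≡ S↭ (a % n)) (↭⇒count≡ T↭ (a / n)) ⟩
      count (a % n) (Zstar n) + δ (a % n) 0 * count (a / n) (Zstar m) ≡⟨ count-Zstar-radix a a<N ⟩
      count a (Zstar N)                                               ∎
      where open ≡-Reasoning

  digit-count≤1 : ∀ {xs ys} → count 0 xs ≡ 0 → (∀ b → count b xs ≤ 1) → (∀ b → count b ys ≤ 1) →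
                  ∀ r q → count r xs + δ r 0 * count q ys ≤ 1
  digit-count≤1 {xs} {ys} xs∌0 _ ys≤1 zero q =
    subst (_≤ 1) (cong₂ _+_ (sym xs∌0) (sym (+-identityʳ (count q ys)))) (ys≤1 q)
  digit-count≤1 {xs} xs∌0 xs≤1 _ (suc r) q = subst (_≤ 1) (sym (+-identityʳ (count (suc r) xs))) (xs≤1 (suc r))

  splits⇒count≤1 : ∀ f {S T} → Splits f S T → All (_< N) (f N (cardioidal n m S T)) →
                   count 0 (f n S) ≡ 0 → (∀ b → count b (f n S) ≤ 1) → (∀ b → count b (f m T) ≤ 1) →
                   ∀ a → count a (f N (cardioidal n m S T)) ≤ 1
  splits⇒count≤1 f {S} {T} f-splits W<N S∌0 S≤1 T≤1 a with a <? N
  ... | no a≮N  = subst (_≤ 1) (sym (All<⇒count≡0 W<N (≮⇒≥ a≮N))) z≤n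
  ... | yes a<N = subst (_≤ 1) (sym (f-splits a a<N)) (digit-count≤1 {f n S} {f m T} S∌0 S≤1 T≤1 (a % n) (a / n))

  splits⇒count0≡0 : ∀ f {S T} → Splits f S T → count 0 (f n S) ≡ 0 → count 0 (f m T) ≡ 0 →
                    count 0 (f N (cardioidal n m S T)) ≡ 0
  splits⇒count0≡0 f f-splits S∌0 T∌0 = ≡-trans (f-splits 0 (>-nonZero⁻¹ N)) (cong₂ (λ u v → u + 1 * v) S∌0 T∌0)

  Transferable : Statistic → Set
  Transferable F = ColumnLifting F × Scaling F × StatisticBelow F

  tally₂-↭ : ∀ {F G S T} → Transferable F → Transferable G → All (PairBelow n) S → All (PairBelow m) T →
             tally₂ F G n S ↭ Zstar n → tally₂ F G m T ↭ Zstar m → tally₂ F G N (cardioidal n m S T) ↭ Zstar N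
  tally₂-↭ {F} {G} {S} {T} (F-lifts , F-scales , F-below) (G-lifts , G-scales , G-below) S<n T<m =
    splits⇒↭ (tally₂ F G) {S} {T}
      (tally₂-splits F G {S} {T} (stat-splits F F-lifts F-scales S<n T<m) (stat-splits G G-lifts G-scales S<n T<m))
      (tally₂-below F-below G-below (cardioidal-below S T))

  cardioidal-starter : Coprime m 2 → ∀ {S T} → IsStarter n S → IsStarter m T → IsStarter N (cardioidal n m S T)
  cardioidal-starter m⊥2 {S} {T} (S-partition , S-differences) (T-partition , T-differences) =
    tally₂-↭ {S = S} {T} (left-lifts , left-scales , left-below) (right-lifts m⊥2 , right-scales , right-below)
             S<n T<m S-partition T-partition ,
    tally₂-↭ {S = S} {T} (difˡ-lifts , difˡ-scales , difˡ-below) (difʳ-lifts , difʳ-scales , difʳ-below)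
             S<n T<m S-differences T-differences
    where
    S<n = twoPartition-bounded S-partition
    T<m = twoPartition-bounded T-partition

  cardioidal-skew : Coprime m 3 → ∀ {S T} → All (PairBelow n) S → All (PairBelow m) T →
                    IsSkew n S → IsSkew m T → IsSkew N (cardioidal n m S T)
  cardioidal-skew m⊥3 =
    tally₂-↭ (sum⁺-lifts m⊥3 , sum⁺-scales , sum⁺-below) (sum⁻-lifts m⊥3 , sum⁻-scales , sum⁻-below)

  cardioidal-strong : Coprime m 3 → ∀ {S T} → All (PairBelow n) S → All (PairBelow m) T →
                      IsStrong n S → IsStrong m T → IsStrong N (cardioidal n m S T)
  cardioidal-strong m⊥3 {S} {T} S<n T<m (S≢0 , S-unique) (T≢0 , T-unique) =
    count0≡0⇒All≢0 (stat sum⁺ N) (cardioidal n m S T) (splits⇒count0≡0 sums {S} {T} sum-splits S∌0 T∌0) ,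
    count≤1⇒Unique _ (splits⇒count≤1 sums {S} {T} sum-splits (map-stat-below sum⁺-below (cardioidal-below S T))
                                      S∌0 (Unique⇒count≤1 S-unique) (Unique⇒count≤1 T-unique))
    where
    sums : ℕ → Pairs → List ℕ
    sums k = map (stat sum⁺ k)
    sum-splits = stat-splits sum⁺ (sum⁺-lifts m⊥3) sum⁺-scales S<n T<m
    S∌0 = All≢0⇒count0≡0 (stat sum⁺ n) S≢0
    T∌0 = All≢0⇒count0≡0 (stat sum⁺ m) T≢0

  column-skolem : n % 2 ≡ 1 → m % 2 ≡ 1 → ∀ {x y} → x < n → y < n → ∣ x - y ∣ ≤ n / 2 →
                  ∀ {i} → i < m → IsSkolemPair N (column x y i)
  column-skolem n-odd m-odd {x} {y} x<n y<n ∣x-y∣≤ {i} i<m = subst (IsSkolemPair N) (sym (column≡ x<n y<n i<m)) (begin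
    ∣ n * i + x - n * twice i + y ∣           ≤⟨ ∣a+b-c+d∣≤∣a-c∣+∣b-d∣ (n * i) x (n * twice i) y ⟩
    ∣ n * i - n * twice i ∣ + ∣ x - y ∣      ≡⟨ cong (_+ ∣ x - y ∣) (*-distribˡ-∣-∣ n i (twice i)) ⟨
    n * ∣ i - twice i ∣ + ∣ x - y ∣          ≤⟨ +-mono-≤ (*-monoʳ-≤ n (∣i-[2*i]%m∣≤m/2 m-odd i<m)) ∣x-y∣≤ ⟩
    n * (m / 2) + n / 2                     ≡⟨ odd*odd/2 n m n-odd m-odd ⟨
    N / 2                                   ∎)
    where open ≤-Reasoning

  scaled-skolem : n % 2 ≡ 1 → m % 2 ≡ 1 → ∀ {r t} → r < m → t < m → ∣ r - t ∣ ≤ m / 2 →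
                  IsSkolemPair N (scaled (r , t))
  scaled-skolem n-odd m-odd {r} {t} r<m t<m ∣r-t∣≤ = subst (IsSkolemPair N) (sym (scaled≡ r<m t<m)) (begin
    ∣ n * r - n * t ∣         ≡⟨ *-distribˡ-∣-∣ n r t ⟨
    n * ∣ r - t ∣             ≤⟨ *-monoʳ-≤ n ∣r-t∣≤ ⟩
    n * (m / 2)               ≤⟨ m≤m+n (n * (m / 2)) (n / 2) ⟩
    n * (m / 2) + n / 2       ≡⟨ odd*odd/2 n m n-odd m-odd ⟨
    N / 2                     ∎)
    where open ≤-Reasoning

  cardioidal-skolem : n % 2 ≡ 1 → m % 2 ≡ 1 → ∀ {S T} → All (PairBelow n) S → All (PairBelow m) T →
                      IsSkolem n S → IsSkolem m T → IsSkolem N (cardioidal n m S T)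
  cardioidal-skolem n-odd m-odd S<n T<m S-skolem T-skolem =
    Allₚ.++⁺ (blocks S<n S-skolem) (Allₚ.map⁺ (scaled-pairs T<m T-skolem))
    where
    blocks : ∀ {S} → All (PairBelow n) S → IsSkolem n S → All (IsSkolemPair N) (concatMap block S)
    blocks []                                 []                  = []
    blocks {(x , y) ∷ _} ((x<n , y<n) ∷ S<n) (∣x-y∣≤ ∷ S-skolem) = Allₚ.++⁺
      (subst (All (IsSkolemPair N)) (sym (block≡ x y))
             (Allₚ.applyUpTo⁺₁ (column x y) m (column-skolem n-odd m-odd x<n y<n ∣x-y∣≤)))
      (blocks S<n S-skolem)
    scaled-pairs : ∀ {T} → All (PairBelow m) T → IsSkolem m T → All (IsSkolemPair N ∘ scaled) T
    scaled-pairs []                  []                  = []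
    scaled-pairs ((r<m , t<m) ∷ T<m) (∣r-t∣≤ ∷ T-skolem) =
      scaled-skolem n-odd m-odd r<m t<m ∣r-t∣≤ ∷ scaled-pairs T<m T-skolem

theorem3p26 : (n m : ℕ) → 3 ≤ n → n % 2 ≡ 1 → 3 ≤ m → m % 2 ≡ 1 → ¬ (3 ∣ m) →
    ((S T : Pairs) → IsStrongSkolemStarter n S → IsStrongSkolemStarter m T →
      IsStrongSkolemStarter (n * m) (cardioidal n m S T))
    × ((S T : Pairs) → IsSkewSkolemStarter n S → IsSkewSkolemStarter m T →
      IsSkewSkolemStarter (n * m) (cardioidal n m S T))
theorem3p26 (suc n₀) (suc m₀) _ n-odd _ m-odd 3∤m = strong , skew
  where
  open Cardioid n₀ m₀
  m⊥2 : Coprime m 2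
  m⊥2 = odd⇒coprime-2 m-odd
  m⊥3 : Coprime m 3
  m⊥3 = prime∤⇒coprime (from-yes (prime? 3)) 3∤m
  strong : ∀ S T → IsStrongSkolemStarter n S → IsStrongSkolemStarter m T → IsStrongSkolemStarter N (cardioidal n m S T)
  strong S T (S-starter , S-strong , S-skolem) (T-starter , T-strong , T-skolem) =
    cardioidal-starter m⊥2 {S} {T} S-starter T-starter ,
    cardioidal-strong m⊥3 S<n T<m S-strong T-strong ,
    cardioidal-skolem n-odd m-odd S<n T<m S-skolem T-skolem
    where
    S<n = twoPartition-bounded (proj₁ S-starter)
    T<m = twoPartition-bounded (proj₁ T-starter)
  skew : ∀ S T → IsSkewSkolemStarter n S → IsSkewSkolemStarter m T → IsSkewSkolemStarter N (cardioidal n m S T)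
  skew S T (S-starter , S-skew , S-skolem) (T-starter , T-skew , T-skolem) =
    cardioidal-starter m⊥2 {S} {T} S-starter T-starter ,
    cardioidal-skew m⊥3 S<n T<m S-skew T-skew ,
    cardioidal-skolem n-odd m-odd S<n T<m S-skolem T-skolem
    where
    S<n = twoPartition-bounded (proj₁ S-starter)
    T<m = twoPartition-bounded (proj₁ T-starter)
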